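{- Let $r\ge1$, $a_1\le\cdots\le a_r$ nonnegative integers and $f(x)=(x+a_1)\cdots(x+a_r)$. For all $j,n\in\mathbb{N}$, $H_{j,n}^f=h_{n-j}(f(1),\dots,f(j))$ equals the number of $f$-Stirling partitions of order $(n,j)$.
   Context: $h_m$ is the complete homogeneous symmetric polynomial of degree $m$ ($h_0=1$, $h_m=0$ for $m<0$, $h_m()=0$ for $m\ge1$). Let $X_n=\{m_i:1\le m\le n,1\le i\le r\}$. An $f$-Stirling partition of order $(n,j)$ is a pair $P=(\pi,(S_1,\dots,S_{a_r}))$, with $\pi$ an unordered collection of $j$ subsets ("blocks") of $X_n$ and $S_1,\dots,S_{a_r}$ an ordered list of possibly empty subsets, such that all these $j+a_r$ sets are pairwise disjoint with union $X_n$, and: every block of $\pi$ is nonempty and contains all copies $m_1,\dots,m_r$ of the smallest number $m$ occurring in it; some block contains $1_1,\dots,1_r$; each $m_i$ lies in a block of $\pi$ or in some $S_l$ with $l\le a_i$. -}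

module Defs where

open import Data.Nat using (ℕ; zero; suc; _+_; _*_; _∸_; _^_; _≤_; _<_; _≤?_)
open import Data.Fin using (Fin; toℕ)
open import Data.Vec using (Vec; lookup; last; toList)
import Data.Vec as Vec
open import Data.List using (List; []; _∷_; upTo)
open import Data.Nat.ListAction using (sum; product)
import Data.List as List
open import Data.Sum using (_⊎_; inj₁; inj₂)
open import Data.Product using (Σ; ∃; ∃-syntax; _×_; _,_)
open import Relation.Nullary using (yes; no)
open import Relation.Binary.PropositionalEquality using (_≡_)

-- Complete homogeneous symmetric polynomial h_m evaluated at a list of naturals:
-- h_m(x_1,...,x_k) = Σ_{e_1+...+e_k = m} x_1^{e_1} ⋯ x_k^{e_k},
-- computed by summing over the exponent e of the first variable.
-- h_0() = 1, h_m() = 0 for m ≥ 1.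
h : ℕ → List ℕ → ℕ
h zero    []       = 1
h (suc m) []       = 0
h m       (x ∷ xs) = sum (List.map (λ e → x ^ e * h (m ∸ e) xs) (upTo (suc m)))

f : ∀ {r} → Vec ℕ r → ℕ → ℕ
f a x = product (toList (Vec.map (x +_) a))

fValues : ∀ {r} → Vec ℕ r → ℕ → List ℕ
fValues a j = List.map (λ k → f a (suc k)) (upTo j)

-- H^f_{j,n} = h_{n-j}(f(1),...,f(j)), with h_m = 0 for m < 0 (i.e. when j > n)
Hf : ∀ {r} → Vec ℕ r → ℕ → ℕ → ℕ
Hf a j n with j ≤? n
... | yes _ = h (n ∸ j) (fValues a j)
... | no  _ = 0

NonDecreasing : ∀ {r} → Vec ℕ r → Set
NonDecreasing {r} a = (i i' : Fin r) → toℕ i ≤ toℕ i' → lookup a i ≤ lookup a i'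

-- Encoding of a pair P = (π, (S_1,...,S_{aR})) on X_n = {m_i}:
-- the element m_i (m : Fin n stands for number toℕ m + 1, i : Fin r for copy toℕ i + 1)
-- gets label  inj₁ k  (it lies in block k of π, k : Fin j)  or
--             inj₂ l  (it lies in S_{toℕ l + 1}).
-- Since the j blocks are unordered, the blocks are indexed canonically:
-- in increasing order of their smallest numbers (see `ordered` below).
Labeling : ℕ → ℕ → ℕ → ℕ → Set
Labeling n r j aR = Vec (Vec (Fin j ⊎ Fin aR) r) n

module _ {n r j aR : ℕ} (L : Labeling n r j aR) where

  lab : Fin n → Fin r → Fin j ⊎ Fin aR
  lab m i = lookup (lookup L m) i

  OccursIn : Fin n → Fin j → Set
  OccursIn m k = ∃[ i ] (lab m i ≡ inj₁ k)

  IsMinOf : Fin n → Fin j → Set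
  IsMinOf m k = OccursIn m k × ((m' : Fin n) → OccursIn m' k → toℕ m ≤ toℕ m')

record IsFStirling {r' : ℕ} (a : Vec ℕ (suc r')) (n j : ℕ)
                   (L : Labeling n (suc r') j (last a)) : Set where
  field
    nonempty  : (k : Fin j) → ∃[ m ] OccursIn L m k
    minCopies : (k : Fin j) (m : Fin n) → IsMinOf L m k →
                (i : Fin (suc r')) → lab L m i ≡ inj₁ k
    hasOne    : (z : Fin n) → toℕ z ≡ 0 → ∃[ k ] ((i : Fin (suc r')) → lab L z i ≡ inj₁ k)
    legal     : (m : Fin n) (i : Fin (suc r')) (l : Fin (last a)) →
                lab L m i ≡ inj₂ l → suc (toℕ l) ≤ lookup a i
    ordered   : (k k' : Fin j) (m m' : Fin n) → toℕ k < toℕ k' →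
                IsMinOf L m k → IsMinOf L m' k' → toℕ m < toℕ m'

-- Remove the largest number n+1. If its copies form a block of their own, that block is the last one
-- (blocks are indexed by their least elements) and what remains is a partition of order (n, j-1).
-- Otherwise the last block already occurs among 1, …, n, what remains is a partition of order (n, j),
-- and each copy (n+1)_i independently goes to one of the j blocks or to one of S_1, …, S_{a_i}, giving
-- f(j) = ∏ (j + a_i) choices. Hence H_{j,n} = H_{j-1,n-1} + f(j) H_{j,n-1}, the recursion of
-- h_{n-j}(f(1), …, f(j)) obtained by splitting off the variable f(j). Sortedness of the a_i only ensures
-- that every S_l with l ≤ a_i is among S_1, …, S_{a_r}.

module Submission where

open import Defs
open import Data.Nat using (ℕ; zero; suc; _+_; _*_; _∸_; _^_; _≤_; _<_; z≤n; s≤s)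
open import Data.Nat.Properties
open import Data.Nat.ListAction using (sum; product)
open import Data.Nat.Solver using (module +-*-Solver)
open import Data.Fin using (Fin; toℕ; fromℕ; inject₁; inject≤; fromℕ<; lower₁)
import Data.Fin.Properties as Fin
open import Data.Fin.Relation.Unary.Top using (view; ‵fromℕ; ‵inject₁)
open import Data.Vec using (Vec; []; _∷_; lookup; last; _∷ʳ_; tabulate; replicate; initLast; toList)
import Data.Vec as Vec
import Data.Vec.Properties as Vec
open import Data.List using (List; []; _∷_; length; map; _++_; [_]; upTo; applyUpTo; allFin; cartesianProductWith)
import Data.List.Properties as List
open import Data.List.Membership.Propositional using (_∈_)
open import Data.List.Membership.Propositional.Properties
  using (∈-++⁺ˡ; ∈-++⁺ʳ; ∈-++⁻; ∈-map⁺; ∈-map⁻; ∈-allFin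
        ; ∈-cartesianProductWith⁺; ∈-cartesianProductWith⁻)
open import Data.List.Relation.Unary.Any using (here)
import Data.List.Relation.Unary.All as All
import Data.List.Relation.Unary.AllPairs as AllPairs
open import Data.List.Relation.Unary.Unique.Propositional using (Unique)
import Data.List.Relation.Unary.Unique.Propositional.Properties as Unique
open import Data.Sum using (_⊎_; inj₁; inj₂)
import Data.Sum as Sum
import Data.Sum.Properties as Sum
open import Data.Product using (∃-syntax; _×_; _,_; proj₁; proj₂)
open import Data.Empty using (⊥-elim)
open import Function.Base using (_∘_; id)
open import Function.Bundles using (_⇔_; mk⇔; Equivalence)
open import Relation.Nullary using (Dec; ¬_; yes; no)
open import Relation.Binary.Definitions using (tri<; tri≈; tri>)
open import Relation.Binary.PropositionalEquality
  using (_≡_; _≢_; _≗_; refl; sym; trans; cong; cong₂; subst; subst₂; module ≡-Reasoning)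

sum-map-*ˡ : ∀ x ys → sum (map (x *_) ys) ≡ x * sum ys
sum-map-*ˡ x []       = sym (*-zeroʳ x)
sum-map-*ˡ x (y ∷ ys) = trans (cong (x * y +_) (sum-map-*ˡ x ys)) (sym (*-distribˡ-+ x y (sum ys)))

h-zero : ∀ xs → h 0 xs ≡ 1
h-zero []       = refl
h-zero (x ∷ xs) = cong (λ t → 1 * t + 0) (h-zero xs)

module _ (x : ℕ) (xs : List ℕ) where

  private
    term : ℕ → ℕ → ℕ
    term m e = x ^ e * h (m ∸ e) xs

  h-∷ : ∀ m → h m (x ∷ xs) ≡ sum (map (term m) (upTo (suc m)))
  h-∷ zero    = refl
  h-∷ (suc m) = refl

  -- Splitting off the exponent 0 of x: the remaining terms all carry a factor x.
  h-suc-∷ : ∀ m → h (suc m) (x ∷ xs) ≡ h (suc m) xs + x * h m (x ∷ xs)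
  h-suc-∷ m = cong₂ _+_ (+-identityʳ (h (suc m) xs)) (begin
      sum (map (term (suc m)) (applyUpTo suc (suc m)))
    ≡⟨ cong sum (List.map-applyUpTo suc (term (suc m)) (suc m)) ⟩
      sum (applyUpTo (term (suc m) ∘ suc) (suc m))
    ≡⟨ cong sum (sym (List.map-applyUpTo id (term (suc m) ∘ suc) (suc m))) ⟩
      sum (map (term (suc m) ∘ suc) (upTo (suc m)))
    ≡⟨ cong sum (List.map-cong (λ e → *-assoc x (x ^ e) (h (m ∸ e) xs)) (upTo (suc m))) ⟩
      sum (map ((x *_) ∘ term m) (upTo (suc m)))
    ≡⟨ cong sum (List.map-∘ (upTo (suc m))) ⟩
      sum (map (x *_) (map (term m) (upTo (suc m))))
    ≡⟨ sum-map-*ˡ x (map (term m) (upTo (suc m))) ⟩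
      x * sum (map (term m) (upTo (suc m)))
    ≡⟨ cong (x *_) (sym (h-∷ m)) ⟩
      x * h m (x ∷ xs)
    ∎)
    where open ≡-Reasoning

h-suc-∷ʳ : ∀ m xs y → h (suc m) (xs ++ [ y ]) ≡ h (suc m) xs + y * h m (xs ++ [ y ])
h-suc-∷ʳ m       []       y = h-suc-∷ y [] m
h-suc-∷ʳ zero    (x ∷ xs) y = begin
    h 1 (x ∷ xs′)
  ≡⟨ h-suc-∷ x xs′ 0 ⟩
    h 1 xs′ + x * h 0 (x ∷ xs′)
  ≡⟨ cong₂ _+_ (h-suc-∷ʳ 0 xs y) (cong (x *_) (h-zero (x ∷ xs′))) ⟩
    (h 1 xs + y * h 0 xs′) + x * 1
  ≡⟨ cong (λ t → (h 1 xs + y * t) + x * 1) (h-zero xs′) ⟩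
    (h 1 xs + y * 1) + x * 1
  ≡⟨ solve 3 (λ A y x → (A :+ y :* con 1) :+ x :* con 1 := (A :+ x :* con 1) :+ y :* con 1) refl (h 1 xs) y x ⟩
    (h 1 xs + x * 1) + y * 1
  ≡⟨ sym (cong₂ (λ s t → (h 1 xs + x * s) + y * t) (h-zero (x ∷ xs)) (h-zero (x ∷ xs′))) ⟩
    (h 1 xs + x * h 0 (x ∷ xs)) + y * h 0 (x ∷ xs′)
  ≡⟨ cong (_+ y * h 0 (x ∷ xs′)) (sym (h-suc-∷ x xs 0)) ⟩
    h 1 (x ∷ xs) + y * h 0 (x ∷ xs′)
  ∎
  where
  open ≡-Reasoning
  open +-*-Solver
  xs′ : List ℕ
  xs′ = xs ++ [ y ]
h-suc-∷ʳ (suc m) (x ∷ xs) y = begin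
    h (2 + m) (x ∷ xs′)
  ≡⟨ h-suc-∷ x xs′ (suc m) ⟩
    h (2 + m) xs′ + x * h (suc m) (x ∷ xs′)
  ≡⟨ cong₂ _+_ (h-suc-∷ʳ (suc m) xs y) (cong (x *_) (h-suc-∷ʳ m (x ∷ xs) y)) ⟩
    (h (2 + m) xs + y * h (suc m) xs′) + x * (h (suc m) (x ∷ xs) + y * h m (x ∷ xs′))
  ≡⟨ solve 6 (λ A y U x P Q → (A :+ y :* U) :+ x :* (P :+ y :* Q) := (A :+ x :* P) :+ y :* (U :+ x :* Q))
           refl (h (2 + m) xs) y (h (suc m) xs′) x (h (suc m) (x ∷ xs)) (h m (x ∷ xs′)) ⟩
    (h (2 + m) xs + x * h (suc m) (x ∷ xs)) + y * (h (suc m) xs′ + x * h m (x ∷ xs′))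
  ≡⟨ sym (cong₂ _+_ (h-suc-∷ x xs (suc m)) (cong (y *_) (h-suc-∷ x xs′ m))) ⟩
    h (2 + m) (x ∷ xs) + y * h (suc m) (x ∷ xs′)
  ∎
  where
  open ≡-Reasoning
  open +-*-Solver
  xs′ : List ℕ
  xs′ = xs ++ [ y ]

module _ {r : ℕ} (a : Vec ℕ r) where

  Hf-≤ : ∀ j n → j ≤ n → Hf a j n ≡ h (n ∸ j) (fValues a j)
  Hf-≤ j n j≤n with j ≤? n
  ... | yes _   = refl
  ... | no  j≰n = ⊥-elim (j≰n j≤n)

  Hf-≰ : ∀ j n → ¬ j ≤ n → Hf a j n ≡ 0
  Hf-≰ j n j≰n with j ≤? n
  ... | yes j≤n = ⊥-elim (j≰n j≤n)
  ... | no  _   = refl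

  Hf-diagonal : ∀ j → Hf a j j ≡ 1
  Hf-diagonal j = trans (Hf-≤ j j ≤-refl) (trans (cong (λ t → h t (fValues a j)) (n∸n≡0 j)) (h-zero (fValues a j)))

  fValues-suc : ∀ j → fValues a (suc j) ≡ fValues a j ++ [ f a (suc j) ]
  fValues-suc j = trans (cong (map (f a ∘ suc)) (sym (List.upTo-∷ʳ j)))
                        (List.map-++ (f a ∘ suc) (upTo j) [ j ])

  Hf-suc-suc : ∀ j n → Hf a (suc j) (suc n) ≡ Hf a j n + f a (suc j) * Hf a (suc j) n
  Hf-suc-suc j n with <-cmp j n
  ... | tri< j<n _ _ = begin
      Hf a (suc j) (suc n)
    ≡⟨ Hf-≤ (suc j) (suc n) (s≤s (<⇒≤ j<n)) ⟩
      h (n ∸ j) (fValues a (suc j))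
    ≡⟨ cong₂ h (+-∸-assoc 1 j<n) (fValues-suc j) ⟩
      h (suc (n ∸ suc j)) (fValues a j ++ [ y ])
    ≡⟨ h-suc-∷ʳ (n ∸ suc j) (fValues a j) y ⟩
      h (suc (n ∸ suc j)) (fValues a j) + y * h (n ∸ suc j) (fValues a j ++ [ y ])
    ≡⟨ sym (cong₂ (λ s t → h s (fValues a j) + y * h (n ∸ suc j) t) (+-∸-assoc 1 j<n) (fValues-suc j)) ⟩
      h (n ∸ j) (fValues a j) + y * h (n ∸ suc j) (fValues a (suc j))
    ≡⟨ sym (cong₂ (λ s t → s + y * t) (Hf-≤ j n (<⇒≤ j<n)) (Hf-≤ (suc j) n j<n)) ⟩
      Hf a j n + y * Hf a (suc j) n
    ∎
    where
    open ≡-Reasoning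
    y : ℕ
    y = f a (suc j)
  ... | tri≈ _ refl _ = begin
      Hf a (suc j) (suc j)     ≡⟨ Hf-diagonal (suc j) ⟩
      1                        ≡⟨ cong (1 +_) (*-zeroʳ (f a (suc j))) ⟨
      1 + f a (suc j) * 0      ≡⟨ cong₂ (λ s t → s + f a (suc j) * t)
                                        (Hf-diagonal j) (Hf-≰ (suc j) j (<⇒≱ ≤-refl)) ⟨
      Hf a j j + f a (suc j) * Hf a (suc j) j
    ∎
    where open ≡-Reasoning
  ... | tri> _ _ n<j = begin
      Hf a (suc j) (suc n)     ≡⟨ Hf-≰ (suc j) (suc n) (<⇒≱ (s≤s n<j)) ⟩
      0                        ≡⟨ *-zeroʳ (f a (suc j)) ⟨
      f a (suc j) * 0          ≡⟨ cong₂ (λ s t → s + f a (suc j) * t)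
                                        (Hf-≰ j n (<⇒≱ n<j)) (Hf-≰ (suc j) n (<⇒≱ (m<n⇒m<1+n n<j))) ⟨
      Hf a j n + f a (suc j) * Hf a (suc j) n
    ∎
    where open ≡-Reasoning

least-witness : ∀ {N} (P : Fin N → Set) → (∀ m → Dec (P m)) → ∃[ m ] P m →
                ∃[ m ] (P m × (∀ m′ → P m′ → toℕ m ≤ toℕ m′))
least-witness P P? (Fin.zero , p) = Fin.zero , p , λ _ _ → z≤n
least-witness P P? (Fin.suc m , p) with P? Fin.zero
... | yes p₀ = Fin.zero , p₀ , λ _ _ → z≤n
... | no ¬p₀ with least-witness (λ m′ → P (Fin.suc m′)) (λ m′ → P? (Fin.suc m′)) (m , p)
...   | k , pk , k-least = Fin.suc k , pk , λ { Fin.zero q → ⊥-elim (¬p₀ q) ; (Fin.suc m′) q → s≤s (k-least m′ q) }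

module _ {A : Set} where

  lookup-ext : ∀ {n} {xs ys : Vec A n} → lookup xs ≗ lookup ys → xs ≡ ys
  lookup-ext {xs = xs} {ys} eq =
    trans (sym (Vec.tabulate∘lookup xs)) (trans (Vec.tabulate-cong eq) (Vec.tabulate∘lookup ys))

  lookup-∷ʳ-inject₁ : ∀ {n} (xs : Vec A n) x i → lookup (xs ∷ʳ x) (inject₁ i) ≡ lookup xs i
  lookup-∷ʳ-inject₁ (y ∷ xs) x Fin.zero    = refl
  lookup-∷ʳ-inject₁ (y ∷ xs) x (Fin.suc i) = lookup-∷ʳ-inject₁ xs x i

  lookup-∷ʳ-fromℕ : ∀ {n} (xs : Vec A n) x → lookup (xs ∷ʳ x) (fromℕ n) ≡ x
  lookup-∷ʳ-fromℕ []       x = refl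
  lookup-∷ʳ-fromℕ (y ∷ xs) x = lookup-∷ʳ-fromℕ xs x

  lookup-fromℕ-last : ∀ {n} (xs : Vec A (suc n)) → lookup xs (fromℕ n) ≡ last xs
  lookup-fromℕ-last (x ∷ [])     = refl
  lookup-fromℕ-last (x ∷ y ∷ ys) = lookup-fromℕ-last (y ∷ ys)

module _ {X Y Z : Set} (_⊕_ : X → Y → Z) where

  length-cartesianProductWith : ∀ xs ys → length (cartesianProductWith _⊕_ xs ys) ≡ length xs * length ys
  length-cartesianProductWith []       ys = refl
  length-cartesianProductWith (x ∷ xs) ys =
    trans (List.length-++ (map (x ⊕_) ys))
          (cong₂ _+_ (List.length-map (x ⊕_) ys) (length-cartesianProductWith xs ys))

module _ {X : Set} where

  vecsOf : ∀ {r} → (Fin r → List X) → List (Vec X r)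
  vecsOf {zero}  xss = [ [] ]
  vecsOf {suc r} xss = cartesianProductWith _∷_ (xss Fin.zero) (vecsOf (λ i → xss (Fin.suc i)))

  ∈-vecsOf⁺ : ∀ {r} {xss : Fin r → List X} {v} → (∀ i → lookup v i ∈ xss i) → v ∈ vecsOf xss
  ∈-vecsOf⁺ {zero}  {v = []}    _  = here refl
  ∈-vecsOf⁺ {suc r} {v = x ∷ v} v∈ =
    ∈-cartesianProductWith⁺ _∷_ (v∈ Fin.zero) (∈-vecsOf⁺ (λ i → v∈ (Fin.suc i)))

  ∈-vecsOf⁻ : ∀ {r} (xss : Fin r → List X) {v} → v ∈ vecsOf xss → ∀ i → lookup v i ∈ xss i
  ∈-vecsOf⁻ {suc r} xss v∈ i with ∈-cartesianProductWith⁻ _∷_ (xss Fin.zero) (vecsOf (λ i → xss (Fin.suc i))) v∈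
  ∈-vecsOf⁻ {suc r} xss v∈ Fin.zero    | x , v , x∈ , v∈′ , refl = x∈
  ∈-vecsOf⁻ {suc r} xss v∈ (Fin.suc i) | x , v , x∈ , v∈′ , refl = ∈-vecsOf⁻ (λ i → xss (Fin.suc i)) v∈′ i

  vecsOf-unique : ∀ {r} {xss : Fin r → List X} → (∀ i → Unique (xss i)) → Unique (vecsOf xss)
  vecsOf-unique {zero}  _ = All.[] AllPairs.∷ AllPairs.[]
  vecsOf-unique {suc r} u =
    Unique.cartesianProductWith⁺ _∷_ Vec.∷-injective (u Fin.zero) (vecsOf-unique (λ i → u (Fin.suc i)))

  length-vecsOf : ∀ {r} {xss : Fin r → List X} (c : Vec ℕ r) → (∀ i → length (xss i) ≡ lookup c i) →
                  length (vecsOf xss) ≡ product (toList c)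
  length-vecsOf []      _   = refl
  length-vecsOf {xss = xss} (c ∷ cs) len =
    trans (length-cartesianProductWith _∷_ (xss Fin.zero) (vecsOf (λ i → xss (Fin.suc i))))
          (cong₂ _*_ (len Fin.zero) (length-vecsOf cs (λ i → len (Fin.suc i))))

inject₁<fromℕ : ∀ {n} (i : Fin n) → toℕ (inject₁ i) < toℕ (fromℕ n)
inject₁<fromℕ {n} i = subst (toℕ (inject₁ i) <_) (sym (Fin.toℕ-fromℕ n)) (Fin.inject₁ℕ< i)

module Stirling {r′ : ℕ} (a : Vec ℕ (suc r′)) where

  Label : ℕ → Set
  Label J = Fin J ⊎ Fin (last a)

  Assignment : ℕ → ℕ → Set
  Assignment N J = Fin N → Fin (suc r′) → Label J

  Occurs : ∀ {N J} → Assignment N J → Fin N → Fin J → Set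
  Occurs g m k = ∃[ i ] (g m i ≡ inj₁ k)

  IsLeast : ∀ {N J} → Assignment N J → Fin N → Fin J → Set
  IsLeast g m k = Occurs g m k × (∀ m′ → Occurs g m′ k → toℕ m ≤ toℕ m′)

  LegalRow : ∀ {J} → (Fin (suc r′) → Label J) → Set
  LegalRow row = ∀ i l → row i ≡ inj₂ l → suc (toℕ l) ≤ lookup a i

  record IsStirling {N J} (g : Assignment N J) : Set where
    field
      nonempty  : ∀ k → ∃[ m ] Occurs g m k
      minCopies : ∀ k m → IsLeast g m k → ∀ i → g m i ≡ inj₁ k
      hasOne    : ∀ z → toℕ z ≡ 0 → ∃[ k ] (∀ i → g z i ≡ inj₁ k)
      legal     : ∀ m → LegalRow (g m)
      ordered   : ∀ k k′ m m′ → toℕ k < toℕ k′ → IsLeast g m k → IsLeast g m′ k′ → toℕ m < toℕ m′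

  isFStirling⇔isStirling : ∀ {n j} {L : Labeling n (suc r′) j (last a)} → IsFStirling a n j L ⇔ IsStirling (lab L)
  isFStirling⇔isStirling = mk⇔
    (λ p → record { nonempty = nonempty p ; minCopies = minCopies p ; hasOne = hasOne p
                  ; legal = legal p ; ordered = ordered p })
    (λ p → record { nonempty = IsStirling.nonempty p ; minCopies = IsStirling.minCopies p
                  ; hasOne = IsStirling.hasOne p ; legal = IsStirling.legal p ; ordered = IsStirling.ordered p })
    where open IsFStirling

  occurs? : ∀ {N J} (g : Assignment N J) m k → Dec (Occurs g m k)
  occurs? g m k = Fin.any? (λ i → Sum.≡-dec Fin._≟_ Fin._≟_ (g m i) (inj₁ k))

  least : ∀ {N J} (g : Assignment N J) k → ∃[ m ] Occurs g m k → ∃[ m ] IsLeast g m k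
  least g k = least-witness (λ m → Occurs g m k) (λ m → occurs? g m k)

  raiseLabel : ∀ {j} → Label j → Label (suc j)
  raiseLabel = Sum.map₁ inject₁

  raiseLabel-injective : ∀ {j} {x y : Label j} → raiseLabel x ≡ raiseLabel y → x ≡ y
  raiseLabel-injective {x = inj₁ _} {inj₁ _} e = cong inj₁ (Fin.inject₁-injective (Sum.inj₁-injective e))
  raiseLabel-injective {x = inj₂ _} {inj₂ _} e = cong inj₂ (Sum.inj₂-injective e)
  raiseLabel-injective {x = inj₁ _} {inj₂ _} ()
  raiseLabel-injective {x = inj₂ _} {inj₁ _} ()

  raiseLabel≢new : ∀ {j} (x : Label j) → raiseLabel x ≢ inj₁ (fromℕ j)
  raiseLabel≢new (inj₁ k) e = Fin.fromℕ≢inject₁ (sym (Sum.inj₁-injective e))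
  raiseLabel≢new (inj₂ l) ()

  raise : ∀ {N j} → Assignment N j → Assignment N (suc j)
  raise g m i = raiseLabel (g m i)

  module _ {N j} (g : Assignment N j) where

    Occurs-raise⁺ : ∀ {m k} → Occurs g m k → Occurs (raise g) m (inject₁ k)
    Occurs-raise⁺ (i , e) = i , cong raiseLabel e

    Occurs-raise⁻ : ∀ {m k} → Occurs (raise g) m (inject₁ k) → Occurs g m k
    Occurs-raise⁻ (i , e) = i , raiseLabel-injective e

    IsLeast-raise⁺ : ∀ {m k} → IsLeast g m k → IsLeast (raise g) m (inject₁ k)
    IsLeast-raise⁺ (o , m-least) = Occurs-raise⁺ o , λ m′ o′ → m-least m′ (Occurs-raise⁻ o′)

    IsLeast-raise⁻ : ∀ {m k} → IsLeast (raise g) m (inject₁ k) → IsLeast g m k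
    IsLeast-raise⁻ (o , m-least) = Occurs-raise⁻ o , λ m′ o′ → m-least m′ (Occurs-raise⁺ o′)

  -- Phrased for the functions lab L, so that a labeling ending in row is described by two equations.
  module Extension {n j} (g⁺ : Assignment (suc n) (suc j)) (g : Assignment n (suc j)) (row : Fin (suc r′) → Label (suc j))
                   (g⁺-inject₁ : ∀ m i → g⁺ (inject₁ m) i ≡ g m i)
                   (g⁺-last : ∀ i → g⁺ (fromℕ n) i ≡ row i) where

    Occurs-inject₁ : ∀ {m k} → Occurs g m k → Occurs g⁺ (inject₁ m) k
    Occurs-inject₁ {m} (i , e) = i , trans (g⁺-inject₁ m i) e

    Occurs-inject₁⁻ : ∀ {m k} → Occurs g⁺ (inject₁ m) k → Occurs g m k
    Occurs-inject₁⁻ {m} (i , e) = i , trans (sym (g⁺-inject₁ m i)) e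

    IsLeast-inject₁ : ∀ {m k} → IsLeast g m k → IsLeast g⁺ (inject₁ m) k
    IsLeast-inject₁ {m} {k} (o , m-least) = Occurs-inject₁ o , below
      where
      below : ∀ m′ → Occurs g⁺ m′ k → toℕ (inject₁ m) ≤ toℕ m′
      below m′ o′ with view m′
      ... | ‵inject₁ m₁ = subst₂ _≤_ (sym (Fin.toℕ-inject₁ m)) (sym (Fin.toℕ-inject₁ m₁))
                                     (m-least m₁ (Occurs-inject₁⁻ o′))
      ... | ‵fromℕ      = <⇒≤ (inject₁<fromℕ m)

    IsLeast-inject₁⁻ : ∀ {m k} → IsLeast g⁺ (inject₁ m) k → IsLeast g m k
    IsLeast-inject₁⁻ {m} (o , m-least) =
      Occurs-inject₁⁻ o , λ m′ o′ → subst₂ _≤_ (Fin.toℕ-inject₁ m) (Fin.toℕ-inject₁ m′)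
                                               (m-least (inject₁ m′) (Occurs-inject₁ o′))

    IsLeast-<n : ∀ {m k} → IsLeast g⁺ m k → toℕ m < n → ∃[ m₁ ] (m ≡ inject₁ m₁ × IsLeast g m₁ k)
    IsLeast-<n {m} mk m<n with view m
    ... | ‵inject₁ m₁ = m₁ , refl , IsLeast-inject₁⁻ mk
    ... | ‵fromℕ      = ⊥-elim (<-irrefl (Fin.toℕ-fromℕ n) m<n)

    IsLeast-old : ∀ {m₀ m k} → Occurs g m₀ k → IsLeast g⁺ m k → ∃[ m₁ ] (m ≡ inject₁ m₁ × IsLeast g m₁ k)
    IsLeast-old {m₀} o mk = IsLeast-<n mk (≤-<-trans (proj₂ mk (inject₁ m₀) (Occurs-inject₁ o)) (Fin.inject₁ℕ< m₀))

    extend⁺ : IsStirling g → LegalRow row → IsStirling g⁺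
    extend⁺ s row-legal = record
      { nonempty = nonempty ; minCopies = minCopies ; hasOne = hasOne ; legal = legal ; ordered = ordered }
      where
      open IsStirling s using () renaming (nonempty to nonempty₀)
      nonempty : ∀ k → ∃[ m ] Occurs g⁺ m k
      nonempty k = let m , o = nonempty₀ k in inject₁ m , Occurs-inject₁ o
      minCopies : ∀ k m → IsLeast g⁺ m k → ∀ i → g⁺ m i ≡ inj₁ k
      minCopies k m mk i with IsLeast-old (proj₂ (nonempty₀ k)) mk
      ... | m₁ , refl , m₁k = trans (g⁺-inject₁ m₁ i) (IsStirling.minCopies s k m₁ m₁k i)
      hasOne : ∀ z → toℕ z ≡ 0 → ∃[ k ] (∀ i → g⁺ z i ≡ inj₁ k)
      hasOne z z≡0 with view z
      ... | ‵inject₁ z₁ = let k , all-k = IsStirling.hasOne s z₁ (trans (sym (Fin.toℕ-inject₁ z₁)) z≡0)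
                          in k , λ i → trans (g⁺-inject₁ z₁ i) (all-k i)
      ... | ‵fromℕ      = let m , _ = nonempty₀ Fin.zero
                          in ⊥-elim (n≮0 (subst (toℕ m <_) (trans (sym (Fin.toℕ-fromℕ n)) z≡0) (Fin.toℕ<n m)))
      legal : ∀ m → LegalRow (g⁺ m)
      legal m i l e with view m
      ... | ‵inject₁ m₁ = IsStirling.legal s m₁ i l (trans (sym (g⁺-inject₁ m₁ i)) e)
      ... | ‵fromℕ      = row-legal i l (trans (sym (g⁺-last i)) e)
      ordered : ∀ k k′ m m′ → toℕ k < toℕ k′ → IsLeast g⁺ m k → IsLeast g⁺ m′ k′ → toℕ m < toℕ m′
      ordered k k′ m m′ k<k′ mk m′k′
        with IsLeast-old (proj₂ (nonempty₀ k)) mk | IsLeast-old (proj₂ (nonempty₀ k′)) m′k′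
      ... | m₁ , refl , m₁k | m₁′ , refl , m₁′k′ =
        subst₂ _<_ (sym (Fin.toℕ-inject₁ m₁)) (sym (Fin.toℕ-inject₁ m₁′))
                   (IsStirling.ordered s k k′ m₁ m₁′ k<k′ m₁k m₁′k′)

    -- Once the last block occurs in g, every block does: its least element precedes that of the last block.
    extend⁻ : IsStirling g⁺ → ∀ {m₀} → Occurs g m₀ (fromℕ j) → IsStirling g × LegalRow row
    extend⁻ s {m₀} o₀ = record
      { nonempty = nonempty ; minCopies = minCopies ; hasOne = hasOne ; legal = legal ; ordered = ordered }
      , λ i l e → IsStirling.legal s (fromℕ n) i l (trans (g⁺-last i) e)
      where
      leastOfLast : ∃[ m ] IsLeast g⁺ m (fromℕ j)
      leastOfLast = least g⁺ (fromℕ j) (IsStirling.nonempty s (fromℕ j))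
      leastOfLast<n : toℕ (proj₁ leastOfLast) < n
      leastOfLast<n = ≤-<-trans (proj₂ (proj₂ leastOfLast) (inject₁ m₀) (Occurs-inject₁ o₀)) (Fin.inject₁ℕ< m₀)
      least<n : ∀ {m} k → IsLeast g⁺ m k → toℕ m < n
      least<n k mk with view k
      ... | ‵inject₁ k₁ = <-trans
        (IsStirling.ordered s (inject₁ k₁) (fromℕ j) _ _ (inject₁<fromℕ k₁) mk (proj₂ leastOfLast))
        leastOfLast<n
      ... | ‵fromℕ      = ≤-<-trans (proj₂ mk _ (proj₁ (proj₂ leastOfLast))) leastOfLast<n
      nonempty : ∀ k → ∃[ m ] Occurs g m k
      nonempty k with least g⁺ k (IsStirling.nonempty s k)
      ... | m , mk with IsLeast-<n mk (least<n k mk)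
      ...   | m₁ , _ , m₁k = m₁ , proj₁ m₁k
      minCopies : ∀ k m → IsLeast g m k → ∀ i → g m i ≡ inj₁ k
      minCopies k m mk i = trans (sym (g⁺-inject₁ m i)) (IsStirling.minCopies s k (inject₁ m) (IsLeast-inject₁ mk) i)
      hasOne : ∀ z → toℕ z ≡ 0 → ∃[ k ] (∀ i → g z i ≡ inj₁ k)
      hasOne z z≡0 = let k , all-k = IsStirling.hasOne s (inject₁ z) (trans (Fin.toℕ-inject₁ z) z≡0)
                     in k , λ i → trans (sym (g⁺-inject₁ z i)) (all-k i)
      legal : ∀ m → LegalRow (g m)
      legal m i l e = IsStirling.legal s (inject₁ m) i l (trans (g⁺-inject₁ m i) e)
      ordered : ∀ k k′ m m′ → toℕ k < toℕ k′ → IsLeast g m k → IsLeast g m′ k′ → toℕ m < toℕ m′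
      ordered k k′ m m′ k<k′ mk m′k′ = subst₂ _<_ (Fin.toℕ-inject₁ m) (Fin.toℕ-inject₁ m′)
        (IsStirling.ordered s k k′ _ _ k<k′ (IsLeast-inject₁ mk) (IsLeast-inject₁ m′k′))

  module NewBlock {n j} (g⁺ : Assignment (suc n) (suc j)) (g : Assignment n j) (row : Fin (suc r′) → Label (suc j))
                  (g⁺-inject₁ : ∀ m i → g⁺ (inject₁ m) i ≡ raiseLabel (g m i))
                  (g⁺-last : ∀ i → g⁺ (fromℕ n) i ≡ row i) where
    open Extension g⁺ (raise g) row g⁺-inject₁ g⁺-last

    IsLeast-raise-inject₁⁺ : ∀ {m k} → IsLeast g m k → IsLeast g⁺ (inject₁ m) (inject₁ k)
    IsLeast-raise-inject₁⁺ mk = IsLeast-inject₁ (IsLeast-raise⁺ g mk)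

    IsLeast-raise-inject₁⁻ : ∀ {m k} → IsLeast g⁺ (inject₁ m) (inject₁ k) → IsLeast g m k
    IsLeast-raise-inject₁⁻ mk = IsLeast-raise⁻ g (IsLeast-inject₁⁻ mk)

    new-at-last : ∀ {m} → Occurs g⁺ m (fromℕ j) → m ≡ fromℕ n
    new-at-last {m} (i , e) with view m
    ... | ‵inject₁ m₁ = ⊥-elim (raiseLabel≢new (g m₁ i) (trans (sym (g⁺-inject₁ m₁ i)) e))
    ... | ‵fromℕ      = refl

    IsLeast-new : ∀ {m} → Occurs g⁺ m (fromℕ j) → IsLeast g⁺ (fromℕ n) (fromℕ j)
    IsLeast-new o = subst (λ m → Occurs g⁺ m (fromℕ j)) (new-at-last o) o
                  , λ m′ o′ → ≤-reflexive (cong toℕ (sym (new-at-last o′)))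

    newBlock-row : IsStirling g⁺ → ∀ i → row i ≡ inj₁ (fromℕ j)
    newBlock-row s i = let _ , o = IsStirling.nonempty s (fromℕ j)
                       in trans (sym (g⁺-last i)) (IsStirling.minCopies s (fromℕ j) (fromℕ n) (IsLeast-new o) i)

    module _ (row-new : ∀ i → row i ≡ inj₁ (fromℕ j)) where

      last-in-new : ∀ {k} → Occurs g⁺ (fromℕ n) k → k ≡ fromℕ j
      last-in-new (i , e) = Sum.inj₁-injective (trans (sym e) (trans (g⁺-last i) (row-new i)))

      old-block : ∀ {m k} → Occurs g⁺ (inject₁ m) k → ∃[ k₁ ] (k ≡ inject₁ k₁)
      old-block {m} {k} o with view k
      ... | ‵inject₁ k₁ = k₁ , refl
      ... | ‵fromℕ      = ⊥-elim (Fin.fromℕ≢inject₁ (sym (new-at-last o)))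

      old-position : ∀ {m k} → Occurs g⁺ m (inject₁ k) → ∃[ m₁ ] (m ≡ inject₁ m₁)
      old-position {m} o with view m
      ... | ‵inject₁ m₁ = m₁ , refl
      ... | ‵fromℕ      = ⊥-elim (Fin.fromℕ≢inject₁ (sym (last-in-new o)))

      newBlock⁺ : IsStirling g → IsStirling g⁺
      newBlock⁺ s = record
        { nonempty = nonempty ; minCopies = minCopies ; hasOne = hasOne ; legal = legal ; ordered = ordered }
        where
        nonempty : ∀ k → ∃[ m ] Occurs g⁺ m k
        nonempty k with view k
        ... | ‵inject₁ k₁ = let m , o = IsStirling.nonempty s k₁ in inject₁ m , Occurs-inject₁ (Occurs-raise⁺ g o)
        ... | ‵fromℕ      = fromℕ n , Fin.zero , trans (g⁺-last Fin.zero) (row-new Fin.zero)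
        minCopies : ∀ k m → IsLeast g⁺ m k → ∀ i → g⁺ m i ≡ inj₁ k
        minCopies k m mk i with view m
        ... | ‵fromℕ      = trans (g⁺-last i) (trans (row-new i) (cong inj₁ (sym (last-in-new (proj₁ mk)))))
        ... | ‵inject₁ m₁ with old-block (proj₁ mk)
        ...   | k₁ , refl = trans (g⁺-inject₁ m₁ i)
                                  (cong raiseLabel (IsStirling.minCopies s k₁ m₁ (IsLeast-raise-inject₁⁻ mk) i))
        hasOne : ∀ z → toℕ z ≡ 0 → ∃[ k ] (∀ i → g⁺ z i ≡ inj₁ k)
        hasOne z z≡0 with view z
        ... | ‵fromℕ      = fromℕ j , λ i → trans (g⁺-last i) (row-new i)
        ... | ‵inject₁ z₁ = let k , all-k = IsStirling.hasOne s z₁ (trans (sym (Fin.toℕ-inject₁ z₁)) z≡0)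
                            in inject₁ k , λ i → trans (g⁺-inject₁ z₁ i) (cong raiseLabel (all-k i))
        legal : ∀ m → LegalRow (g⁺ m)
        legal m i l e with view m
        ... | ‵inject₁ m₁ = IsStirling.legal s m₁ i l (raiseLabel-injective (trans (sym (g⁺-inject₁ m₁ i)) e))
        ... | ‵fromℕ with trans (sym e) (trans (g⁺-last i) (row-new i))
        ...   | ()
        ordered : ∀ k k′ m m′ → toℕ k < toℕ k′ → IsLeast g⁺ m k → IsLeast g⁺ m′ k′ → toℕ m < toℕ m′
        ordered k k′ m m′ k<k′ mk m′k′ with view m | view m′
        ... | ‵fromℕ      | ‵fromℕ       =
          ⊥-elim (<-irrefl (cong toℕ (trans (last-in-new (proj₁ mk)) (sym (last-in-new (proj₁ m′k′))))) k<k′)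
        ... | ‵inject₁ m₁ | ‵fromℕ       = inject₁<fromℕ m₁
        ... | _           | ‵inject₁ m₁′ with old-block (proj₁ m′k′)
        ordered k _ _ _ k<k′ mk m′k′ | ‵fromℕ | ‵inject₁ m₁′ | k₁′ , refl with last-in-new (proj₁ mk)
        ... | refl = ⊥-elim (<-asym k<k′ (inject₁<fromℕ k₁′))
        ordered k _ _ _ k<k′ mk m′k′ | ‵inject₁ m₁ | ‵inject₁ m₁′ | k₁′ , refl with old-block (proj₁ mk)
        ... | k₁ , refl = subst₂ _<_ (sym (Fin.toℕ-inject₁ m₁)) (sym (Fin.toℕ-inject₁ m₁′))
          (IsStirling.ordered s k₁ k₁′ m₁ m₁′ (subst₂ _<_ (Fin.toℕ-inject₁ k₁) (Fin.toℕ-inject₁ k₁′) k<k′)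
                              (IsLeast-raise-inject₁⁻ mk) (IsLeast-raise-inject₁⁻ m′k′))

      newBlock⁻ : IsStirling g⁺ → IsStirling g
      newBlock⁻ s = record
        { nonempty = nonempty ; minCopies = minCopies ; hasOne = hasOne ; legal = legal ; ordered = ordered }
        where
        nonempty : ∀ k → ∃[ m ] Occurs g m k
        nonempty k with IsStirling.nonempty s (inject₁ k)
        ... | m , o with old-position o
        ...   | m₁ , refl = m₁ , Occurs-raise⁻ g (Occurs-inject₁⁻ o)
        minCopies : ∀ k m → IsLeast g m k → ∀ i → g m i ≡ inj₁ k
        minCopies k m mk i = raiseLabel-injective
          (trans (sym (g⁺-inject₁ m i)) (IsStirling.minCopies s (inject₁ k) (inject₁ m) (IsLeast-raise-inject₁⁺ mk) i))
        hasOne : ∀ z → toℕ z ≡ 0 → ∃[ k ] (∀ i → g z i ≡ inj₁ k)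
        hasOne z z≡0 with IsStirling.hasOne s (inject₁ z) (trans (Fin.toℕ-inject₁ z) z≡0)
        ... | k , all-k with old-block (Fin.zero , all-k Fin.zero)
        ...   | k₁ , refl = k₁ , λ i → raiseLabel-injective (trans (sym (g⁺-inject₁ z i)) (all-k i))
        legal : ∀ m → LegalRow (g m)
        legal m i l e = IsStirling.legal s (inject₁ m) i l (trans (g⁺-inject₁ m i) (cong raiseLabel e))
        ordered : ∀ k k′ m m′ → toℕ k < toℕ k′ → IsLeast g m k → IsLeast g m′ k′ → toℕ m < toℕ m′
        ordered k k′ m m′ k<k′ mk m′k′ = subst₂ _<_ (Fin.toℕ-inject₁ m) (Fin.toℕ-inject₁ m′)
          (IsStirling.ordered s (inject₁ k) (inject₁ k′) (inject₁ m) (inject₁ m′)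
                              (subst₂ _<_ (sym (Fin.toℕ-inject₁ k)) (sym (Fin.toℕ-inject₁ k′)) k<k′)
                              (IsLeast-raise-inject₁⁺ mk) (IsLeast-raise-inject₁⁺ m′k′))

lookup≤last : ∀ {r} {a : Vec ℕ (suc r)} → NonDecreasing a → ∀ i → lookup a i ≤ last a
lookup≤last {r} {a} nd i = subst (lookup a i ≤_) (lookup-fromℕ-last a) (nd i (fromℕ r) (Fin.≤fromℕ i))

module Enumeration {r′ : ℕ} (a : Vec ℕ (suc r′)) (a≤last : ∀ i → lookup a i ≤ last a) where
  open Stirling a

  private
    R : ℕ
    R = suc r′
    A : ℕ
    A = last a

  labelsBelow : ∀ J c → c ≤ A → List (Label J)
  labelsBelow J c c≤A = map inj₁ (allFin J) ++ map (λ l → inj₂ (inject≤ l c≤A)) (allFin c)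

  length-labelsBelow : ∀ J c (c≤A : c ≤ A) → length (labelsBelow J c c≤A) ≡ J + c
  length-labelsBelow J c c≤A = trans (List.length-++ (map inj₁ (allFin J)))
    (cong₂ _+_ (trans (List.length-map inj₁ (allFin J)) (List.length-tabulate {n = J} id))
               (trans (List.length-map (λ l → inj₂ (inject≤ l c≤A)) (allFin c)) (List.length-tabulate {n = c} id)))

  labelsBelow-unique : ∀ J c (c≤A : c ≤ A) → Unique (labelsBelow J c c≤A)
  labelsBelow-unique J c c≤A = Unique.++⁺
    (Unique.map⁺ Sum.inj₁-injective (Unique.allFin⁺ J))
    (Unique.map⁺ (λ e → Fin.inject≤-injective c≤A c≤A _ _ (Sum.inj₂-injective e)) (Unique.allFin⁺ c))
    disjoint
    where
    disjoint : ∀ {x} → ¬ (x ∈ map inj₁ (allFin J) × x ∈ map (λ l → inj₂ (inject≤ l c≤A)) (allFin c))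
    disjoint (p , q) with ∈-map⁻ inj₁ p | ∈-map⁻ (λ l → inj₂ (inject≤ l c≤A)) q
    ... | _ , _ , refl | _ , _ , ()

  ∈-labelsBelow⁻ : ∀ {J c} (c≤A : c ≤ A) {x} → x ∈ labelsBelow J c c≤A → ∀ l → x ≡ inj₂ l → suc (toℕ l) ≤ c
  ∈-labelsBelow⁻ {J} {c} c≤A x∈ l e with ∈-++⁻ (map inj₁ (allFin J)) x∈
  ... | inj₁ p with ∈-map⁻ inj₁ p
  ...   | _ , _ , refl with e
  ...     | ()
  ∈-labelsBelow⁻ {J} {c} c≤A x∈ l e | inj₂ q with ∈-map⁻ (λ l → inj₂ (inject≤ l c≤A)) q
  ... | l′ , _ , refl =
    subst (λ t → suc t ≤ c) (trans (sym (Fin.toℕ-inject≤ l′ c≤A)) (cong toℕ (Sum.inj₂-injective e))) (Fin.toℕ<n l′)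

  ∈-labelsBelow⁺ : ∀ {J c} (c≤A : c ≤ A) x → (∀ l → x ≡ inj₂ l → suc (toℕ l) ≤ c) → x ∈ labelsBelow J c c≤A
  ∈-labelsBelow⁺         c≤A (inj₁ k) _     = ∈-++⁺ˡ (∈-map⁺ inj₁ (∈-allFin k))
  ∈-labelsBelow⁺ {J} {c} c≤A (inj₂ l) l<c = ∈-++⁺ʳ (map inj₁ (allFin J))
    (subst (_∈ map (λ l → inj₂ (inject≤ l c≤A)) (allFin c)) (cong inj₂ inject≤-fromℕ<)
           (∈-map⁺ (λ l → inj₂ (inject≤ l c≤A)) (∈-allFin (fromℕ< (l<c l refl)))))
    where
    inject≤-fromℕ< : inject≤ (fromℕ< (l<c l refl)) c≤A ≡ l
    inject≤-fromℕ< = Fin.toℕ-injective (trans (Fin.toℕ-inject≤ _ c≤A) (Fin.toℕ-fromℕ< (l<c l refl)))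

  legalRows : ∀ J → List (Vec (Label J) R)
  legalRows J = vecsOf (λ i → labelsBelow J (lookup a i) (a≤last i))

  ∈-legalRows⁺ : ∀ {J} {row : Vec (Label J) R} → LegalRow (lookup row) → row ∈ legalRows J
  ∈-legalRows⁺ {row = row} legal = ∈-vecsOf⁺ (λ i → ∈-labelsBelow⁺ (a≤last i) (lookup row i) (legal i))

  ∈-legalRows⁻ : ∀ {J} {row : Vec (Label J) R} → row ∈ legalRows J → LegalRow (lookup row)
  ∈-legalRows⁻ {J} row∈ i =
    ∈-labelsBelow⁻ (a≤last i) (∈-vecsOf⁻ (λ i → labelsBelow J (lookup a i) (a≤last i)) row∈ i)

  legalRows-unique : ∀ J → Unique (legalRows J)
  legalRows-unique J = vecsOf-unique (λ i → labelsBelow-unique J (lookup a i) (a≤last i))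

  length-legalRows : ∀ J → length (legalRows J) ≡ f a J
  length-legalRows J = length-vecsOf {xss = λ i → labelsBelow J (lookup a i) (a≤last i)} (Vec.map (J +_) a)
    (λ i → trans (length-labelsBelow J (lookup a i) (a≤last i)) (sym (Vec.lookup-map i (J +_) a)))

  lab-ext : ∀ {n J} {L L′ : Labeling n R J A} → (∀ m i → lab L m i ≡ lab L′ m i) → L ≡ L′
  lab-ext eq = lookup-ext (λ m → lookup-ext (eq m))

  lab-∷ʳ-inject₁ : ∀ {n J} (L : Labeling n R J A) row m i → lab (L ∷ʳ row) (inject₁ m) i ≡ lab L m i
  lab-∷ʳ-inject₁ L row m i = cong (λ v → lookup v i) (lookup-∷ʳ-inject₁ L row m)

  lab-∷ʳ-fromℕ : ∀ {n J} (L : Labeling n R J A) row i → lab (L ∷ʳ row) (fromℕ n) i ≡ lookup row i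
  lab-∷ʳ-fromℕ L row i = cong (λ v → lookup v i) (lookup-∷ʳ-fromℕ L row)

  raiseLabeling : ∀ {n j} → Labeling n R j A → Labeling n R (suc j) A
  raiseLabeling = Vec.map (Vec.map raiseLabel)

  lab-raiseLabeling : ∀ {n j} (L : Labeling n R j A) m i → lab (raiseLabeling L) m i ≡ raiseLabel (lab L m i)
  lab-raiseLabeling L m i = trans (cong (λ v → lookup v i) (Vec.lookup-map m (Vec.map raiseLabel) L))
                                  (Vec.lookup-map i raiseLabel (lookup L m))

  raiseLabeling-injective : ∀ {n j} {L L′ : Labeling n R j A} → raiseLabeling L ≡ raiseLabeling L′ → L ≡ L′
  raiseLabeling-injective {L = L} {L′} e = lab-ext λ m i → raiseLabel-injective
    (trans (sym (lab-raiseLabeling L m i)) (trans (cong (λ X → lab X m i) e) (lab-raiseLabeling L′ m i)))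

  lowerLabel : ∀ {j} (x : Label (suc j)) → x ≢ inj₁ (fromℕ j) → Label j
  lowerLabel {j} (inj₁ k) x≢new =
    inj₁ (lower₁ k λ j≡k → x≢new (cong inj₁ (Fin.toℕ-injective (trans (sym j≡k) (sym (Fin.toℕ-fromℕ j))))))
  lowerLabel (inj₂ l) _ = inj₂ l

  raiseLabel-lowerLabel : ∀ {j} (x : Label (suc j)) x≢new → raiseLabel (lowerLabel x x≢new) ≡ x
  raiseLabel-lowerLabel (inj₁ k) _ = cong inj₁ (Fin.inject₁-lower₁ k _)
  raiseLabel-lowerLabel (inj₂ l) _ = refl

  lowerLabeling : ∀ {n j} (L : Labeling n R (suc j) A) → (∀ m i → lab L m i ≢ inj₁ (fromℕ j)) → Labeling n R j A
  lowerLabeling L L≢new = tabulate λ m → tabulate λ i → lowerLabel (lab L m i) (L≢new m i)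

  raiseLabeling-lowerLabeling : ∀ {n j} (L : Labeling n R (suc j) A) L≢new → raiseLabeling (lowerLabeling L L≢new) ≡ L
  raiseLabeling-lowerLabeling L L≢new = lab-ext λ m i → begin
      lab (raiseLabeling (lowerLabeling L L≢new)) m i
    ≡⟨ lab-raiseLabeling (lowerLabeling L L≢new) m i ⟩
      raiseLabel (lookup (lookup (tabulate (lowered-row)) m) i)
    ≡⟨ cong (λ v → raiseLabel (lookup v i)) (Vec.lookup∘tabulate lowered-row m) ⟩
      raiseLabel (lookup (lowered-row m) i)
    ≡⟨ cong raiseLabel (Vec.lookup∘tabulate (λ i → lowerLabel (lab L m i) (L≢new m i)) i) ⟩
      raiseLabel (lowerLabel (lab L m i) (L≢new m i))
    ≡⟨ raiseLabel-lowerLabel (lab L m i) (L≢new m i) ⟩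
      lab L m i
    ∎
    where
    open ≡-Reasoning
    lowered-row : ∀ m → Vec (Label _) R
    lowered-row m = tabulate λ i → lowerLabel (lab L m i) (L≢new m i)

  addSingleton : ∀ {n j} → Labeling n R j A → Labeling (suc n) R (suc j) A
  addSingleton {j = j} L = raiseLabeling L ∷ʳ replicate R (inj₁ (fromℕ j))

  addSingleton-injective : ∀ {n j} {L L′ : Labeling n R j A} → addSingleton L ≡ addSingleton L′ → L ≡ L′
  addSingleton-injective {L = L} {L′} e = raiseLabeling-injective (Vec.∷ʳ-injectiveˡ (raiseLabeling L) (raiseLabeling L′) e)

  module ExtendLabeling {n j} (L : Labeling n R (suc j) A) (row : Vec (Label (suc j)) R) =
    Extension (lab (L ∷ʳ row)) (lab L) (lookup row) (lab-∷ʳ-inject₁ L row) (lab-∷ʳ-fromℕ L row)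

  module NewBlockLabeling {n j} (L : Labeling n R j A) (L⁺ : Labeling n R (suc j) A) (L⁺≡ : raiseLabeling L ≡ L⁺)
                          (row : Vec (Label (suc j)) R) =
    NewBlock (lab (L⁺ ∷ʳ row)) (lab L) (lookup row)
      (λ m i → trans (lab-∷ʳ-inject₁ L⁺ row m i) (trans (cong (λ X → lab X m i) (sym L⁺≡)) (lab-raiseLabeling L m i)))
      (lab-∷ʳ-fromℕ L⁺ row)

  partitions : ∀ j n → List (Labeling n R j A)
  partitions zero    zero    = [ [] ]
  partitions (suc j) zero    = []
  partitions zero    (suc n) = []
  partitions (suc j) (suc n) =
    map addSingleton (partitions j n) ++ cartesianProductWith _∷ʳ_ (partitions (suc j) n) (legalRows (suc j))

  length-partitions : ∀ j n → length (partitions j n) ≡ Hf a j n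
  length-partitions zero    zero    = refl
  length-partitions (suc j) zero    = sym (Hf-≰ a (suc j) 0 λ ())
  length-partitions zero    (suc n) = sym (Hf-≤ a 0 (suc n) z≤n)
  length-partitions (suc j) (suc n) = begin
      length (singletons ++ extensions)
    ≡⟨ List.length-++ singletons ⟩
      length singletons + length extensions
    ≡⟨ cong₂ _+_ (List.length-map addSingleton (partitions j n))
                 (length-cartesianProductWith _∷ʳ_ (partitions (suc j) n) (legalRows (suc j))) ⟩
      length (partitions j n) + length (partitions (suc j) n) * length (legalRows (suc j))
    ≡⟨ cong₂ _+_ (length-partitions j n) (cong₂ _*_ (length-partitions (suc j) n) (length-legalRows (suc j))) ⟩
      Hf a j n + Hf a (suc j) n * f a (suc j)
    ≡⟨ cong (Hf a j n +_) (*-comm (Hf a (suc j) n) (f a (suc j))) ⟩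
      Hf a j n + f a (suc j) * Hf a (suc j) n
    ≡⟨ Hf-suc-suc a j n ⟨
      Hf a (suc j) (suc n)
    ∎
    where
    open ≡-Reasoning
    singletons : List (Labeling (suc n) R (suc j) A)
    singletons = map addSingleton (partitions j n)
    extensions : List (Labeling (suc n) R (suc j) A)
    extensions = cartesianProductWith _∷ʳ_ (partitions (suc j) n) (legalRows (suc j))

  ∈-partitions⁻ : ∀ j n {P} → P ∈ partitions j n → IsStirling (lab P)
  ∈-partitions⁻ zero    zero    (here refl) = record
    { nonempty = λ () ; minCopies = λ () ; hasOne = λ () ; legal = λ () ; ordered = λ () }
  ∈-partitions⁻ (suc j) (suc n) P∈ with ∈-++⁻ (map addSingleton (partitions j n)) P∈
  ... | inj₁ p with ∈-map⁻ addSingleton p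
  ...   | L , L∈ , refl = NewBlockLabeling.newBlock⁺ L (raiseLabeling L) refl (replicate R (inj₁ (fromℕ j)))
                            (λ i → Vec.lookup-replicate i _) (∈-partitions⁻ j n L∈)
  ∈-partitions⁻ (suc j) (suc n) P∈ | inj₂ q
    with ∈-cartesianProductWith⁻ _∷ʳ_ (partitions (suc j) n) (legalRows (suc j)) q
  ... | L , row , L∈ , row∈ , refl = ExtendLabeling.extend⁺ L row (∈-partitions⁻ (suc j) n L∈) (∈-legalRows⁻ row∈)

  ∈-partitions⁺ : ∀ j n {P} → IsStirling (lab P) → P ∈ partitions j n
  ∈-partitions⁺ zero    zero    {[]} _ = here refl
  ∈-partitions⁺ (suc j) zero    s with IsStirling.nonempty s Fin.zero
  ... | () , _
  ∈-partitions⁺ zero    (suc n) s with IsStirling.hasOne s Fin.zero refl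
  ... | () , _
  ∈-partitions⁺ (suc j) (suc n) {P} s with initLast P
  ... | L , row , refl with Fin.any? (λ m → occurs? (lab L) m (fromℕ j))
  ...   | yes (m₀ , o₀) = let s′ , legal = ExtendLabeling.extend⁻ L row s o₀ in
    ∈-++⁺ʳ (map addSingleton (partitions j n))
           (∈-cartesianProductWith⁺ _∷ʳ_ (∈-partitions⁺ (suc j) n s′) (∈-legalRows⁺ legal))
  ...   | no ¬occ =
    ∈-++⁺ˡ (subst (_∈ map addSingleton (partitions j n)) (sym P≡) (∈-map⁺ addSingleton (∈-partitions⁺ j n s′)))
    where
    L≢new : ∀ m i → lab L m i ≢ inj₁ (fromℕ j)
    L≢new m i e = ¬occ (m , i , e)
    L′ : Labeling n R j A
    L′ = lowerLabeling L L≢new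
    open NewBlockLabeling L′ L (raiseLabeling-lowerLabeling L L≢new) row
    s′ : IsStirling (lab L′)
    s′ = newBlock⁻ (newBlock-row s) s
    P≡ : L ∷ʳ row ≡ addSingleton L′
    P≡ = cong₂ _∷ʳ_ (sym (raiseLabeling-lowerLabeling L L≢new))
                    (lookup-ext λ i → trans (newBlock-row s i) (sym (Vec.lookup-replicate i _)))

  partitions-unique : ∀ j n → Unique (partitions j n)
  partitions-unique zero    zero    = All.[] AllPairs.∷ AllPairs.[]
  partitions-unique (suc j) zero    = AllPairs.[]
  partitions-unique zero    (suc n) = AllPairs.[]
  partitions-unique (suc j) (suc n) = Unique.++⁺
    (Unique.map⁺ addSingleton-injective (partitions-unique j n))
    (Unique.cartesianProductWith⁺ _∷ʳ_ (Vec.∷ʳ-injective _ _) (partitions-unique (suc j) n) (legalRows-unique (suc j)))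
    disjoint
    where
    -- The last block of a labeling in the second part already occurs among 1, …, n.
    disjoint : ∀ {P} → ¬ (P ∈ map addSingleton (partitions j n) ×
                          P ∈ cartesianProductWith _∷ʳ_ (partitions (suc j) n) (legalRows (suc j)))
    disjoint (p , q) with ∈-map⁻ addSingleton p
    ... | L , _ , refl with ∈-cartesianProductWith⁻ _∷ʳ_ (partitions (suc j) n) (legalRows (suc j)) q
    ...   | L′ , row , L′∈ , _ , e with IsStirling.nonempty (∈-partitions⁻ (suc j) n L′∈) (fromℕ j)
    ...     | m , i , new = raiseLabel≢new (lab L m i) (trans (sym (lab-raiseLabeling L m i))
                              (trans (cong (λ X → lab X m i) (Vec.∷ʳ-injectiveˡ _ _ e)) new))

corollaryC : (r' : ℕ) (a : Vec ℕ (suc r')) → NonDecreasing a → (j n : ℕ) →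
    ∃[ Ps ] (Unique Ps ×
             ((P : Labeling n (suc r') j (last a)) → (P ∈ Ps ⇔ IsFStirling a n j P)) ×
             length Ps ≡ Hf a j n)
corollaryC r' a nd j n =
    partitions j n
  , partitions-unique j n
  , (λ P → mk⇔ (from isFStirling⇔isStirling ∘ ∈-partitions⁻ j n)
               (∈-partitions⁺ j n ∘ to isFStirling⇔isStirling))
  , length-partitions j n
  where
  open Stirling a using (isFStirling⇔isStirling)
  open Enumeration a (lookup≤last nd)
  open Equivalence
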